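{- Let $F$ be a non-exceptional isonemal fabric, drawn on the unit-cell grid so that the cells are the squares $[i,i+1]\times[j,j+1]$ ($i,j\in\mathbb{Z}$). Stripe it thickly, the warp pairs occupying $[2a,2a+2]\times\mathbb{R}$ and the weft pairs $\mathbb{R}\times[2b,2b+2]$ ($a,b\in\mathbb{Z}$), and give every warp pair and every weft pair a colour different from the colours of all other pairs. Put $\delta=\sqrt2$. Suppose that the thick stripes are preserved by the symmetries of $F$, i.e. that the plane isometries $t$ underlying the elements $(t,r)$ of the symmetry group $G_1$ of $F$ satisfy: 1. every translation in $G_1$ has horizontal and vertical components $x,y$ that are even integers (in cell widths); 2. every centre of a half-turn lies at a corner of a cell (an integer point); 3. every centre of a quarter-turn lies at a corner or a centre of a block (a point with both coordinates even or both odd); 4. every glide-reflection with diagonal axis either (a) has its axis through block centres and glide an even multiple of $\delta$, or (b) has its axis through centres of cells but not through block centres and glide an odd multiple of $\delta$; 5. every diagonal mirror axis passes through block centres. Then this colouring is a perfect colouring of $F$.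
   Context: Cells are unit squares tessellating the plane; vertical strips of cells are warps, horizontal strips are wefts. A prefabric assigns to each cell which of its two crossing strands lies on top; its design colours the cell dark if the warp is on top, pale otherwise. A fabric is a prefabric that does not fall apart. Let $\tau$ denote reflection in the plane of the fabric (it reverses which strand is on top everywhere). The symmetry group $G_1$ consists of pairs $(t,r)$ with $t$ an isometry of the plane mapping the cell tessellation (hence strands) to itself and $r\in\{e,\tau\}$, such that: if $r=e$, whenever strand $a$ lies over strand $b$ at a cell $C$ then $t(a)$ lies over $t(b)$ at $t(C)$; if $r=\tau$, then $t(a)$ lies under $t(b)$ at $t(C)$. The prefabric is isonemal if it is periodic (doubly periodic design) and $G_1$ acts transitively on the set of all strands. The order is the period of the design along a strand; non-exceptional means order greater than four. Thick striping: each pair of adjacent strands as described is given one colour; a block is a $2\times2$ square $[2a,2a+2]\times[2b,2b+2]$ where a warp pair crosses a weft pair. An element $(t,r)$ of $G_1$ is a colour symmetry if for each colour, $t$ maps all strands of that colour onto strands of a single common colour (so it induces a consistent map of colours). A colouring is perfect if every element of $G_1$ is a colour symmetry. -}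

module Defs where

open import Data.Bool using (Bool; true; false; not; _xor_)
open import Data.Nat using (ℕ; _≤_; _<_)
open import Data.Integer using (ℤ; +_; -_; _+_; _-_; _*_)
open import Data.Integer.DivMod using (_/_)
open import Data.Product using (_×_; _,_; ∃; ∃-syntax; Σ)
open import Data.Sum using (_⊎_)
open import Data.Empty using (⊥)
open import Data.Unit using (⊤)
open import Relation.Binary.PropositionalEquality using (_≡_; _≢_)
open import Relation.Nullary using (¬_)

-- Cell (i , j)
-- is the square [i,i+1] × [j,j+1].  Points with half-integer coordinates
-- are handled in *doubled* coordinates: the pair (X , Y) denotes (X/2 , Y/2).

Cell : Set
Cell = ℤ × ℤ

-- warp i occupies [i,i+1] × ℝ ; weft j occupies ℝ × [j,j+1]
data Strand : Set where
  warp : ℤ → Strand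
  weft : ℤ → Strand

-- Linear parts of isometries preserving the square grid (dihedral group D4):
-- L(x , y) = (±p₁ , ±p₂) where (p₁ , p₂) = (y , x) if swap, else (x , y);
-- neg₁ / neg₂ say whether the respective coordinate is negated.
record Lin : Set where
  constructor lin
  field
    swap neg₁ neg₂ : Bool

-- Every isometry of the plane mapping the cell tessellation to itself maps
-- corners (ℤ²) to corners, hence is p ↦ L p + v with L ∈ D4 and v ∈ ℤ².
record Iso : Set where
  constructor iso
  field
    linear : Lin
    v₁ v₂  : ℤ
open Iso public

private
  sgn : Bool → ℤ → ℤ
  sgn false x = x
  sgn true  x = - x

  -- image of the unit interval [k,k+1] under x ↦ ±x is [k',k'+1]
  sgnCell : Bool → ℤ → ℤ
  sgnCell false k = k
  sgnCell true  k = (- k) - (+ 1)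

actPoint2 : Iso → ℤ × ℤ → ℤ × ℤ
actPoint2 (iso (lin false n₁ n₂) a b) (X , Y) = (sgn n₁ X + (+ 2) * a , sgn n₂ Y + (+ 2) * b)
actPoint2 (iso (lin true  n₁ n₂) a b) (X , Y) = (sgn n₁ Y + (+ 2) * a , sgn n₂ X + (+ 2) * b)

actCell : Iso → Cell → Cell
actCell (iso (lin false n₁ n₂) a b) (i , j) = (sgnCell n₁ i + a , sgnCell n₂ j + b)
actCell (iso (lin true  n₁ n₂) a b) (i , j) = (sgnCell n₁ j + a , sgnCell n₂ i + b)

actStrand : Iso → Strand → Strand
actStrand (iso (lin false n₁ n₂) a b) (warp i) = warp (sgnCell n₁ i + a)
actStrand (iso (lin false n₁ n₂) a b) (weft j) = weft (sgnCell n₂ j + b)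
actStrand (iso (lin true  n₁ n₂) a b) (warp i) = weft (sgnCell n₂ i + b)
actStrand (iso (lin true  n₁ n₂) a b) (weft j) = warp (sgnCell n₁ j + a)

-- Prefabrics.  A prefabric is given by its design:
-- F i j ≡ true (dark) iff the warp is on top at cell (i , j).

Prefabric : Set
Prefabric = ℤ → ℤ → Bool

Over : Prefabric → Strand → Strand → Cell → Set
Over F (warp i) (weft j) (c₁ , c₂) = (c₁ ≡ i) × (c₂ ≡ j) × (F i j ≡ true)
Over F (weft j) (warp i) (c₁ , c₂) = (c₁ ≡ i) × (c₂ ≡ j) × (F i j ≡ false)
Over F _ _ _ = ⊥

Crosses : Strand → Strand → Cell → Set
Crosses (warp i) (weft j) (c₁ , c₂) = (c₁ ≡ i) × (c₂ ≡ j)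
Crosses (weft j) (warp i) (c₁ , c₂) = (c₁ ≡ i) × (c₂ ≡ j)
Crosses _ _ _ = ⊥

FallsApart : Prefabric → Set
FallsApart F = Σ (Strand → Bool) λ P →
  (∃ λ s → P s ≡ true) × (∃ λ s → P s ≡ false) ×
  (∀ a b C → P a ≡ true → P b ≡ false → Crosses a b C → Over F a b C)

IsFabric : Prefabric → Set
IsFabric F = ¬ FallsApart F

-- The symmetry group G₁.  r ≡ false is e, r ≡ true is τ.

Sym : Set
Sym = Iso × Bool

InG1 : Prefabric → Sym → Set
InG1 F (t , false) = ∀ a b C → Over F a b C → Over F (actStrand t a) (actStrand t b) (actCell t C)
InG1 F (t , true)  = ∀ a b C → Over F a b C → Over F (actStrand t b) (actStrand t a) (actCell t C)

Periodic : Prefabric → Set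
Periodic F = ∃ λ p₁ → ∃ λ p₂ → ∃ λ q₁ → ∃ λ q₂ →
  (p₁ * q₂ - p₂ * q₁ ≢ + 0) ×
  (∀ i j → F (i + p₁) (j + p₂) ≡ F i j) ×
  (∀ i j → F (i + q₁) (j + q₂) ≡ F i j)

Isonemal : Prefabric → Set
Isonemal F = Periodic F ×
  (∀ s s' → ∃ λ g → InG1 F g × actStrand (Data.Product.proj₁ g) s ≡ s')

along : Prefabric → Strand → ℤ → Bool
along F (warp i) k = F i k
along F (weft j) k = F k j

PeriodAlong : Prefabric → Strand → ℕ → Set
PeriodAlong F s p = ∀ k → along F s (k + + p) ≡ along F s k

-- order > 4: every (positive) period of the design along any strand exceeds 4,
-- i.e. the least period (the order) is greater than four
NonExceptional : Prefabric → Set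
NonExceptional F = ∀ s (p : ℕ) → 1 ≤ p → PeriodAlong F s p → 4 < p

data Colour : Set where
  warpPair : ℤ → Colour
  weftPair : ℤ → Colour

colour : Strand → Colour
colour (warp i) = warpPair (i / (+ 2))
colour (weft j) = weftPair (j / (+ 2))

ColourSymmetry : Sym → Set
ColourSymmetry (t , r) = ∀ s s' → colour s ≡ colour s' →
  colour (actStrand t s) ≡ colour (actStrand t s')

PerfectColouring : Prefabric → Set
PerfectColouring F = ∀ g → InG1 F g → ColourSymmetry g

IsTranslation : Iso → Set
IsTranslation t = Iso.linear t ≡ lin false false false

IsHalfTurn : Iso → Set
IsHalfTurn t = Iso.linear t ≡ lin false true true

-- rotations by ±90°: (x,y) ↦ (-y,x) and (x,y) ↦ (y,-x)
IsQuarterTurn : Iso → Set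
IsQuarterTurn t = (Iso.linear t ≡ lin true true false) ⊎ (Iso.linear t ≡ lin true false true)

Centre2 : Iso → ℤ × ℤ → Set
Centre2 t P = actPoint2 t P ≡ P

-- (x,y) ↦ (y,x) + v  or  (x,y) ↦ (-y,-x) + v : reflections / glide-reflections
-- with diagonal axis
IsDiagonal : Iso → Set
IsDiagonal t = (Iso.linear t ≡ lin true false false) ⊎ (Iso.linear t ≡ lin true true true)

-- Axis of a diagonal (glide-)reflection, in doubled coordinates.
--  (x,y) ↦ (y + v₁ , x + v₂): reflection in y = x + c followed by translation
--    by (s , s), with c = (v₂ - v₁)/2, s = (v₁ + v₂)/2.
--  (x,y) ↦ (-y + v₁ , -x + v₂): reflection in x + y = c followed by translation
--    by (s , -s), with c = (v₁ + v₂)/2, s = (v₁ - v₂)/2.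
OnAxis2 : Iso → ℤ × ℤ → Set
OnAxis2 (iso (lin true false false) a b) (X , Y) = Y ≡ X + (b - a)
OnAxis2 (iso (lin true true true) a b) (X , Y) = X + Y ≡ a + b
OnAxis2 _ _ = ⊥

-- 2s, where the glide vector is s·(1,±1), of length |s|·δ (δ = √2)
Glide2 : Iso → ℤ
Glide2 (iso (lin true false false) a b) = a + b
Glide2 (iso (lin true true true) a b) = a - b
Glide2 _ = + 0

-- block centres are (2a+1 , 2b+1); cell centres are (i+1/2 , j+1/2)
AxisThroughBlockCentres : Iso → Set
AxisThroughBlockCentres t = ∃ λ a → ∃ λ b →
  OnAxis2 t ((+ 2) * ((+ 2) * a + + 1) , (+ 2) * ((+ 2) * b + + 1))

AxisThroughCellCentres : Iso → Set
AxisThroughCellCentres t = ∃ λ i → ∃ λ j →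
  OnAxis2 t ((+ 2) * i + + 1 , (+ 2) * j + + 1)

-- s = 2k·… : glide is an even multiple of δ ; s = 2k+1 : odd multiple
EvenMultipleOfδ : ℤ → Set
EvenMultipleOfδ S2 = ∃ λ k → S2 ≡ (+ 2) * ((+ 2) * k)

OddMultipleOfδ : ℤ → Set
OddMultipleOfδ S2 = ∃ λ k → S2 ≡ (+ 2) * ((+ 2) * k + + 1)

CellCorner2 : ℤ × ℤ → Set
CellCorner2 (X , Y) = ∃ λ a → ∃ λ b → (X ≡ (+ 2) * a) × (Y ≡ (+ 2) * b)

BlockCornerOrCentre2 : ℤ × ℤ → Set
BlockCornerOrCentre2 (X , Y) = ∃ λ a → ∃ λ b →
  ((X ≡ (+ 2) * ((+ 2) * a)) × (Y ≡ (+ 2) * ((+ 2) * b))) ⊎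
  ((X ≡ (+ 2) * ((+ 2) * a + + 1)) × (Y ≡ (+ 2) * ((+ 2) * b + + 1)))

ThickStripesPreserved : Prefabric → Set
ThickStripesPreserved F =
  (∀ t r → InG1 F (t , r) → IsTranslation t →
     ∃ λ x → ∃ λ y → (Iso.v₁ t ≡ (+ 2) * x) × (Iso.v₂ t ≡ (+ 2) * y)) ×
  (∀ t r → InG1 F (t , r) → IsHalfTurn t → ∀ P → Centre2 t P → CellCorner2 P) ×
  (∀ t r → InG1 F (t , r) → IsQuarterTurn t → ∀ P → Centre2 t P → BlockCornerOrCentre2 P) ×
  (∀ t r → InG1 F (t , r) → IsDiagonal t → Glide2 t ≢ + 0 →
     (AxisThroughBlockCentres t × EvenMultipleOfδ (Glide2 t)) ⊎
     (AxisThroughCellCentres t × ¬ AxisThroughBlockCentres t × OddMultipleOfδ (Glide2 t))) ×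
  (∀ t r → InG1 F (t , r) → IsDiagonal t → Glide2 t ≡ + 0 → AxisThroughBlockCentres t)

module Submission where

-- A symmetry whose translation part (v₁ , v₂) is even sends the two strands of each thick
-- stripe onto the two strands of a single thick stripe, so it is a colour symmetry; it
-- remains to show that every element of G₁ has even translation part.  For a symmetry
-- exchanging warps and wefts, in doubled coordinates the centre of a quarter-turn, and the
-- pair (glide, axis intercept) of a diagonal (glide-)reflection, is by hypotheses 3–5 a
-- block corner or block centre; so the sum and the difference of its coordinates are
-- multiples of 4, and the translation components are half of them.  Isonemality supplies
-- such a symmetry h, and for every other symmetry g the composite g h also exchanges warps
-- and wefts, so g is even too.

open import Data.Bool using (Bool; true; false; _xor_)
open import Data.Empty using (⊥-elim)
open import Data.Integer using (ℤ; +_; +[1+_]; -[1+_]; -_; _+_; _-_; _*_)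
open import Data.Integer.DivMod using (_/_; _%_; n%d<d; a≡a%n+[a/n]*n)
open import Data.Integer.Properties
  using (+-identityˡ; +-comm; +-assoc; *-comm; *-distribˡ-+; *-cancelˡ-≡; _≟_)
open import Data.Integer.Tactic.RingSolver using (solve; solve-∀)
open import Data.List using ([]; _∷_)
open import Data.Nat using (suc; s≤s)
open import Data.Product using (_×_; _,_; ∃; swap)
open import Data.Sum using (_⊎_; inj₁; inj₂)
open import Relation.Binary.PropositionalEquality
open import Relation.Nullary using (¬_; yes; no)

open import Defs

open ≡-Reasoning

Even : ℤ → Set
Even m = ∃ λ k → m ≡ + 2 * k

FourDivides : ℤ → Set
FourDivides m = ∃ λ k → m ≡ + 2 * (+ 2 * k)

TwiceOdd : ℤ → Set
TwiceOdd m = ∃ λ k → m ≡ + 2 * (+ 2 * k + + 1)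

infix 4 _∈Pair_

_∈Pair_ : ℤ → ℤ → Set
i ∈Pair p = i ≡ + 2 * p ⊎ i ≡ + 2 * p + + 1

twice≢1 : ∀ k → + 2 * k ≢ + 1
twice≢1 (+ 0) ()
twice≢1 (+ 1) ()
twice≢1 +[1+ suc n ] ()
twice≢1 -[1+ n ] ()

even≢odd : ∀ p q → + 2 * p ≢ + 2 * q + + 1
even≢odd p q e = twice≢1 (p - q) (begin
  + 2 * (p - q)            ≡⟨ solve (p ∷ q ∷ []) ⟩
  + 2 * p - + 2 * q        ≡⟨ cong (_- + 2 * q) e ⟩
  + 2 * q + + 1 - + 2 * q  ≡⟨ solve (q ∷ []) ⟩
  + 1                      ∎)

∈Pair-/2 : ∀ i → i ∈Pair (i / + 2)
∈Pair-/2 i with i / + 2 | i % + 2 | n%d<d i (+ 2) | a≡a%n+[a/n]*n i (+ 2)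
... | q | 0           | _             | i≡ =
  inj₁ (trans i≡ (trans (+-identityˡ (q * + 2)) (*-comm q (+ 2))))
... | q | 1           | _             | i≡ =
  inj₂ (trans i≡ (trans (+-comm (+ 1) (q * + 2)) (cong (_+ + 1) (*-comm q (+ 2)))))
... | _ | suc (suc _) | s≤s (s≤s ()) | _

∈Pair-unique : ∀ {i p q} → i ∈Pair p → i ∈Pair q → p ≡ q
∈Pair-unique         (inj₁ refl) (inj₁ e) = *-cancelˡ-≡ (+ 2) _ _ e
∈Pair-unique {p = p} {q} (inj₂ refl) (inj₂ e) = *-cancelˡ-≡ (+ 2) p q (begin
  + 2 * p                ≡⟨ solve (p ∷ []) ⟩
  + 2 * p + + 1 - + 1    ≡⟨ cong (_- + 1) e ⟩
  + 2 * q + + 1 - + 1    ≡⟨ solve (q ∷ []) ⟩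
  + 2 * q                ∎)
∈Pair-unique {p = p} {q} (inj₁ refl) (inj₂ e) = ⊥-elim (even≢odd p q e)
∈Pair-unique {p = p} {q} (inj₂ refl) (inj₁ e) = ⊥-elim (even≢odd q p (sym e))

∈Pair⇒/2≡ : ∀ {i p} → i ∈Pair p → i / + 2 ≡ p
∈Pair⇒/2≡ {i} = ∈Pair-unique (∈Pair-/2 i)

fourDivides⊎twiceOdd : ∀ {m} → Even m → FourDivides m ⊎ TwiceOdd m
fourDivides⊎twiceOdd (k , refl) with ∈Pair-/2 k
... | inj₁ e = inj₁ (k / + 2 , cong (+ 2 *_) e)
... | inj₂ e = inj₂ (k / + 2 , cong (+ 2 *_) e)

half-even : ∀ u k → + 2 * u ≡ + 2 * (+ 2 * k) → Even u
half-even u k e = k , *-cancelˡ-≡ (+ 2) u _ e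

mirrorCell : Bool → ℤ → ℤ
mirrorCell false k = k
mirrorCell true  k = - k - + 1

∈Pair-mirrorCell : ∀ n x {i p} → i ∈Pair p → mirrorCell n i + + 2 * x ∈Pair mirrorCell n p + x
∈Pair-mirrorCell false x {p = p} (inj₁ refl) = inj₁ (sym (*-distribˡ-+ (+ 2) p x))
∈Pair-mirrorCell false x {p = p} (inj₂ refl) = inj₂ (shift p x)
  where
  shift : ∀ p x → + 2 * p + + 1 + + 2 * x ≡ + 2 * (p + x) + + 1
  shift = solve-∀
∈Pair-mirrorCell true  x {p = p} (inj₁ refl) = inj₂ (reflect p x)
  where
  reflect : ∀ p x → - (+ 2 * p) - + 1 + + 2 * x ≡ + 2 * (- p - + 1 + x) + + 1
  reflect = solve-∀
∈Pair-mirrorCell true  x {p = p} (inj₂ refl) = inj₁ (reflect p x)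
  where
  reflect : ∀ p x → - (+ 2 * p + + 1) - + 1 + + 2 * x ≡ + 2 * (- p - + 1 + x)
  reflect = solve-∀

/2-mirrorCell : ∀ n x i → (mirrorCell n i + + 2 * x) / + 2 ≡ mirrorCell n (i / + 2) + x
/2-mirrorCell n x i = ∈Pair⇒/2≡ (∈Pair-mirrorCell n x (∈Pair-/2 i))

-- actStrand and actCell, with the reflection of a coordinate (private in Defs) made nameable.
strandImage : Iso → Strand → Strand
strandImage (iso (lin false n₁ n₂) a b) (warp i) = warp (mirrorCell n₁ i + a)
strandImage (iso (lin false n₁ n₂) a b) (weft j) = weft (mirrorCell n₂ j + b)
strandImage (iso (lin true  n₁ n₂) a b) (warp i) = weft (mirrorCell n₂ i + b)
strandImage (iso (lin true  n₁ n₂) a b) (weft j) = warp (mirrorCell n₁ j + a)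

cellImage : Iso → Cell → Cell
cellImage (iso (lin false n₁ n₂) a b) (i , j) = (mirrorCell n₁ i + a , mirrorCell n₂ j + b)
cellImage (iso (lin true  n₁ n₂) a b) (i , j) = (mirrorCell n₁ j + a , mirrorCell n₂ i + b)

actStrand≡strandImage : ∀ t s → actStrand t s ≡ strandImage t s
actStrand≡strandImage (iso (lin false false _) _ _) (warp _) = refl
actStrand≡strandImage (iso (lin false true  _) _ _) (warp _) = refl
actStrand≡strandImage (iso (lin false _ false) _ _) (weft _) = refl
actStrand≡strandImage (iso (lin false _ true ) _ _) (weft _) = refl
actStrand≡strandImage (iso (lin true _ false) _ _) (warp _) = refl
actStrand≡strandImage (iso (lin true _ true ) _ _) (warp _) = refl
actStrand≡strandImage (iso (lin true false _) _ _) (weft _) = refl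
actStrand≡strandImage (iso (lin true true  _) _ _) (weft _) = refl

actCell≡cellImage : ∀ t C → actCell t C ≡ cellImage t C
actCell≡cellImage (iso (lin false false false) _ _) _ = refl
actCell≡cellImage (iso (lin false false true ) _ _) _ = refl
actCell≡cellImage (iso (lin false true  false) _ _) _ = refl
actCell≡cellImage (iso (lin false true  true ) _ _) _ = refl
actCell≡cellImage (iso (lin true  false false) _ _) _ = refl
actCell≡cellImage (iso (lin true  false true ) _ _) _ = refl
actCell≡cellImage (iso (lin true  true  false) _ _) _ = refl
actCell≡cellImage (iso (lin true  true  true ) _ _) _ = refl

negateIf : Bool → ℤ → ℤ
negateIf false x = x
negateIf true  x = - x

infixr 9 _∘ᵢ_

_∘ᵢ_ : Iso → Iso → Iso
iso (lin false m₁ m₂) c d ∘ᵢ iso (lin false n₁ n₂) a b =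
  iso (lin false (m₁ xor n₁) (m₂ xor n₂)) (negateIf m₁ a + c) (negateIf m₂ b + d)
iso (lin true  m₁ m₂) c d ∘ᵢ iso (lin false n₁ n₂) a b =
  iso (lin true  (m₁ xor n₂) (m₂ xor n₁)) (negateIf m₁ b + c) (negateIf m₂ a + d)
iso (lin false m₁ m₂) c d ∘ᵢ iso (lin true  n₁ n₂) a b =
  iso (lin true  (m₁ xor n₁) (m₂ xor n₂)) (negateIf m₁ a + c) (negateIf m₂ b + d)
iso (lin true  m₁ m₂) c d ∘ᵢ iso (lin true  n₁ n₂) a b =
  iso (lin false (m₁ xor n₂) (m₂ xor n₁)) (negateIf m₁ b + c) (negateIf m₂ a + d)

mirrorCell-∘ : ∀ m n k x c →
  mirrorCell (m xor n) k + (negateIf m x + c) ≡ mirrorCell m (mirrorCell n k + x) + c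
mirrorCell-∘ false n     k x c = sym (+-assoc (mirrorCell n k) x c)
mirrorCell-∘ true  false k x c = reflect-shift k x c
  where
  reflect-shift : ∀ k x c → - k - + 1 + (- x + c) ≡ - (k + x) - + 1 + c
  reflect-shift = solve-∀
mirrorCell-∘ true  true  k x c = reflect-reflect k x c
  where
  reflect-reflect : ∀ k x c → k + (- x + c) ≡ - (- k - + 1 + x) - + 1 + c
  reflect-reflect = solve-∀

strandImage-∘ : ∀ t u s → strandImage (t ∘ᵢ u) s ≡ strandImage t (strandImage u s)
strandImage-∘ (iso (lin false m₁ m₂) c d) (iso (lin false n₁ n₂) a b) (warp i) =
  cong warp (mirrorCell-∘ m₁ n₁ i a c)
strandImage-∘ (iso (lin false m₁ m₂) c d) (iso (lin false n₁ n₂) a b) (weft j) =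
  cong weft (mirrorCell-∘ m₂ n₂ j b d)
strandImage-∘ (iso (lin true  m₁ m₂) c d) (iso (lin false n₁ n₂) a b) (warp i) =
  cong weft (mirrorCell-∘ m₂ n₁ i a d)
strandImage-∘ (iso (lin true  m₁ m₂) c d) (iso (lin false n₁ n₂) a b) (weft j) =
  cong warp (mirrorCell-∘ m₁ n₂ j b c)
strandImage-∘ (iso (lin false m₁ m₂) c d) (iso (lin true  n₁ n₂) a b) (warp i) =
  cong weft (mirrorCell-∘ m₂ n₂ i b d)
strandImage-∘ (iso (lin false m₁ m₂) c d) (iso (lin true  n₁ n₂) a b) (weft j) =
  cong warp (mirrorCell-∘ m₁ n₁ j a c)
strandImage-∘ (iso (lin true  m₁ m₂) c d) (iso (lin true  n₁ n₂) a b) (warp i) =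
  cong warp (mirrorCell-∘ m₁ n₂ i b c)
strandImage-∘ (iso (lin true  m₁ m₂) c d) (iso (lin true  n₁ n₂) a b) (weft j) =
  cong weft (mirrorCell-∘ m₂ n₁ j a d)

cellImage-∘ : ∀ t u C → cellImage (t ∘ᵢ u) C ≡ cellImage t (cellImage u C)
cellImage-∘ (iso (lin false m₁ m₂) c d) (iso (lin false n₁ n₂) a b) (i , j) =
  cong₂ _,_ (mirrorCell-∘ m₁ n₁ i a c) (mirrorCell-∘ m₂ n₂ j b d)
cellImage-∘ (iso (lin true  m₁ m₂) c d) (iso (lin false n₁ n₂) a b) (i , j) =
  cong₂ _,_ (mirrorCell-∘ m₁ n₂ j b c) (mirrorCell-∘ m₂ n₁ i a d)
cellImage-∘ (iso (lin false m₁ m₂) c d) (iso (lin true  n₁ n₂) a b) (i , j) =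
  cong₂ _,_ (mirrorCell-∘ m₁ n₁ j a c) (mirrorCell-∘ m₂ n₂ i b d)
cellImage-∘ (iso (lin true  m₁ m₂) c d) (iso (lin true  n₁ n₂) a b) (i , j) =
  cong₂ _,_ (mirrorCell-∘ m₁ n₂ i b c) (mirrorCell-∘ m₂ n₁ j a d)

actStrand-∘ : ∀ t u s → actStrand (t ∘ᵢ u) s ≡ actStrand t (actStrand u s)
actStrand-∘ t u s = begin
  actStrand (t ∘ᵢ u) s             ≡⟨ actStrand≡strandImage (t ∘ᵢ u) s ⟩
  strandImage (t ∘ᵢ u) s           ≡⟨ strandImage-∘ t u s ⟩
  strandImage t (strandImage u s)  ≡⟨ cong (strandImage t) (actStrand≡strandImage u s) ⟨
  strandImage t (actStrand u s)    ≡⟨ actStrand≡strandImage t (actStrand u s) ⟨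
  actStrand t (actStrand u s)      ∎

actCell-∘ : ∀ t u C → actCell (t ∘ᵢ u) C ≡ actCell t (actCell u C)
actCell-∘ t u C = begin
  actCell (t ∘ᵢ u) C           ≡⟨ actCell≡cellImage (t ∘ᵢ u) C ⟩
  cellImage (t ∘ᵢ u) C         ≡⟨ cellImage-∘ t u C ⟩
  cellImage t (cellImage u C)  ≡⟨ cong (cellImage t) (actCell≡cellImage u C) ⟨
  cellImage t (actCell u C)    ≡⟨ actCell≡cellImage t (actCell u C) ⟨
  actCell t (actCell u C)      ∎

Over-∘ : ∀ {F} t u {x y C} →
  Over F (actStrand t (actStrand u x)) (actStrand t (actStrand u y)) (actCell t (actCell u C)) →
  Over F (actStrand (t ∘ᵢ u) x) (actStrand (t ∘ᵢ u) y) (actCell (t ∘ᵢ u) C)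
Over-∘ t u {x} {y} {C} o rewrite actStrand-∘ t u x | actStrand-∘ t u y | actCell-∘ t u C = o

InG1-∘ : ∀ {F t u} r r' → InG1 F (t , r) → InG1 F (u , r') → InG1 F (t ∘ᵢ u , r xor r')
InG1-∘ {t = t} {u} false false gt gu a b C o = Over-∘ t u (gt _ _ _ (gu a b C o))
InG1-∘ {t = t} {u} false true  gt gu a b C o = Over-∘ t u (gt _ _ _ (gu a b C o))
InG1-∘ {t = t} {u} true  false gt gu a b C o = Over-∘ t u (gt _ _ _ (gu a b C o))
InG1-∘ {t = t} {u} true  true  gt gu a b C o = Over-∘ t u (gt _ _ _ (gu a b C o))

blockCorner : ∀ {X Y} → FourDivides X → FourDivides Y → BlockCornerOrCentre2 (X , Y)
blockCorner (k , eX) (l , eY) = k , l , inj₁ (eX , eY)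

blockCentre : ∀ {X Y} → TwiceOdd X → TwiceOdd Y → BlockCornerOrCentre2 (X , Y)
blockCentre (k , eX) (l , eY) = k , l , inj₂ (eX , eY)

BlockCornerOrCentre2-swap : ∀ {X Y} → BlockCornerOrCentre2 (X , Y) → BlockCornerOrCentre2 (Y , X)
BlockCornerOrCentre2-swap (k , l , inj₁ (eX , eY)) = l , k , inj₁ (eY , eX)
BlockCornerOrCentre2-swap (k , l , inj₂ (eX , eY)) = l , k , inj₂ (eY , eX)

twiceOdd-sum : ∀ k l → + 2 * (+ 2 * k + + 1) + + 2 * (+ 2 * l + + 1) ≡ + 2 * (+ 2 * (k + l + + 1))
twiceOdd-sum = solve-∀

twiceOdd-diff : ∀ k l → + 2 * (+ 2 * l + + 1) - + 2 * (+ 2 * k + + 1) ≡ + 2 * (+ 2 * (l - k))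
twiceOdd-diff = solve-∀

odd-sum : ∀ i j → + 2 * i + + 1 + (+ 2 * j + + 1) ≡ + 2 * (i + j + + 1)
odd-sum = solve-∀

odd-diff : ∀ i j → + 2 * j + + 1 - (+ 2 * i + + 1) ≡ + 2 * (j - i)
odd-diff = solve-∀

blockPoint-halves : ∀ {X Y} u v → BlockCornerOrCentre2 (X , Y) →
  + 2 * u ≡ X + Y → + 2 * v ≡ Y - X → Even u × Even v
blockPoint-halves u v (k , l , inj₁ (refl , refl)) sum diff =
  half-even u (k + l) (trans sum (corner-sum k l)) ,
  half-even v (l - k) (trans diff (corner-diff k l))
  where
  corner-sum : ∀ k l → + 2 * (+ 2 * k) + + 2 * (+ 2 * l) ≡ + 2 * (+ 2 * (k + l))
  corner-sum = solve-∀
  corner-diff : ∀ k l → + 2 * (+ 2 * l) - + 2 * (+ 2 * k) ≡ + 2 * (+ 2 * (l - k))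
  corner-diff = solve-∀
blockPoint-halves u v (k , l , inj₂ (refl , refl)) sum diff =
  half-even u (k + l + + 1) (trans sum (twiceOdd-sum k l)) ,
  half-even v (l - k) (trans diff (twiceOdd-diff k l))

-- (a − b , a + b) and (a + b , b − a) are (a , b) turned through ±45° and scaled by √2.
halves-even⁺ : ∀ a b → BlockCornerOrCentre2 (a - b , a + b) → Even a × Even b
halves-even⁺ a b p = blockPoint-halves a b p (sum a b) (diff a b)
  where
  sum : ∀ a b → + 2 * a ≡ a - b + (a + b)
  sum = solve-∀
  diff : ∀ a b → + 2 * b ≡ a + b - (a - b)
  diff = solve-∀

halves-even⁻ : ∀ a b → BlockCornerOrCentre2 (a + b , b - a) → Even a × Even b
halves-even⁻ a b p = swap (blockPoint-halves b a (BlockCornerOrCentre2-swap p) (sum a b) (diff a b))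
  where
  sum : ∀ a b → + 2 * b ≡ b - a + (a + b)
  sum = solve-∀
  diff : ∀ a b → + 2 * a ≡ a + b - (b - a)
  diff = solve-∀

anticlockwiseQuarterTurn-centre : ∀ a b → Centre2 (iso (lin true true false) a b) (a - b , a + b)
anticlockwiseQuarterTurn-centre a b = cong₂ _,_ (first a b) (second a b)
  where
  first : ∀ a b → - (a + b) + + 2 * a ≡ a - b
  first = solve-∀
  second : ∀ a b → a - b + + 2 * b ≡ a + b
  second = solve-∀

clockwiseQuarterTurn-centre : ∀ a b → Centre2 (iso (lin true false true) a b) (a + b , b - a)
clockwiseQuarterTurn-centre a b = cong₂ _,_ (first a b) (second a b)
  where
  first : ∀ a b → b - a + + 2 * a ≡ a + b
  first = solve-∀
  second : ∀ a b → - (a + b) + + 2 * b ≡ b - a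
  second = solve-∀

diagonalOffset : ∀ {X Y D} → Y ≡ X + D → D ≡ Y - X
diagonalOffset {X} {Y} {D} on = begin
  D          ≡⟨ cancel X D ⟩
  X + D - X  ≡⟨ cong (_- X) on ⟨
  Y - X      ∎
  where
  cancel : ∀ X D → D ≡ X + D - X
  cancel = solve-∀

diagonalGlide antidiagonalGlide : ℤ → ℤ → Iso
diagonalGlide     a b = iso (lin true false false) a b
antidiagonalGlide a b = iso (lin true true  true ) a b

module _ (a b : ℤ) where

  diagonal-throughBlockCentres : AxisThroughBlockCentres (diagonalGlide a b) → FourDivides (b - a)
  diagonal-throughBlockCentres (x , y , on) = y - x , trans (diagonalOffset on) (twiceOdd-diff x y)

  diagonal-throughBlockCentres⁻¹ : FourDivides (b - a) → AxisThroughBlockCentres (diagonalGlide a b)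
  diagonal-throughBlockCentres⁻¹ (q , four) = + 0 , q , trans (split q) (cong (_+_ (+ 2)) (sym four))
    where
    split : ∀ q → + 2 * (+ 2 * q + + 1) ≡ + 2 + + 2 * (+ 2 * q)
    split = solve-∀

  diagonal-throughCellCentres : AxisThroughCellCentres (diagonalGlide a b) →
    ¬ AxisThroughBlockCentres (diagonalGlide a b) → TwiceOdd (b - a)
  diagonal-throughCellCentres (i , j , on) ¬blocks
    with fourDivides⊎twiceOdd (j - i , trans (diagonalOffset on) (odd-diff i j))
  ... | inj₁ four = ⊥-elim (¬blocks (diagonal-throughBlockCentres⁻¹ four))
  ... | inj₂ odd  = odd

  antidiagonal-throughBlockCentres : AxisThroughBlockCentres (antidiagonalGlide a b) → FourDivides (a + b)
  antidiagonal-throughBlockCentres (x , y , on) = x + y + + 1 , trans (sym on) (twiceOdd-sum x y)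

  antidiagonal-throughBlockCentres⁻¹ : FourDivides (a + b) → AxisThroughBlockCentres (antidiagonalGlide a b)
  antidiagonal-throughBlockCentres⁻¹ (q , four) = q - + 1 , + 0 , trans (split q) (sym four)
    where
    split : ∀ q → + 2 * (+ 2 * (q - + 1) + + 1) + + 2 ≡ + 2 * (+ 2 * q)
    split = solve-∀

  antidiagonal-throughCellCentres : AxisThroughCellCentres (antidiagonalGlide a b) →
    ¬ AxisThroughBlockCentres (antidiagonalGlide a b) → TwiceOdd (a + b)
  antidiagonal-throughCellCentres (i , j , on) ¬blocks
    with fourDivides⊎twiceOdd (i + j + + 1 , trans (sym on) (odd-sum i j))
  ... | inj₁ four = ⊥-elim (¬blocks (antidiagonal-throughBlockCentres⁻¹ four))
  ... | inj₂ odd  = odd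

GlideCondition : Iso → Set
GlideCondition t =
  (AxisThroughBlockCentres t × EvenMultipleOfδ (Glide2 t)) ⊎
  (AxisThroughCellCentres t × ¬ AxisThroughBlockCentres t × OddMultipleOfδ (Glide2 t))

DiagonalAxisCondition : Iso → Set
DiagonalAxisCondition t = (Glide2 t ≡ + 0 × AxisThroughBlockCentres t) ⊎ GlideCondition t

diagonalAxisCondition : ∀ {F} → ThickStripesPreserved F → ∀ t {r} → InG1 F (t , r) → IsDiagonal t →
  DiagonalAxisCondition t
diagonalAxisCondition (_ , _ , _ , glides , mirrors) t g diagonal with Glide2 t ≟ + 0
... | yes glide≡0 = inj₁ (glide≡0 , mirrors _ _ g diagonal glide≡0)
... | no  glide≢0 = inj₂ (glides _ _ g diagonal glide≢0)

-- D is the intercept of the axis with the line X = 0, in doubled coordinates.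
axisCondition-blockPoint : ∀ t {D} → DiagonalAxisCondition t →
  (AxisThroughBlockCentres t → FourDivides D) →
  (AxisThroughCellCentres t → ¬ AxisThroughBlockCentres t → TwiceOdd D) →
  BlockCornerOrCentre2 (Glide2 t , D)
axisCondition-blockPoint _ (inj₁ (mirror , blocks)) blocks⇒ _ =
  blockCorner (+ 0 , mirror) (blocks⇒ blocks)
axisCondition-blockPoint _ (inj₂ (inj₁ (blocks , even))) blocks⇒ _ =
  blockCorner even (blocks⇒ blocks)
axisCondition-blockPoint _ (inj₂ (inj₂ (cells , ¬blocks , odd))) _ cells⇒ =
  blockCentre odd (cells⇒ cells ¬blocks)

swapping-evenTranslation : ∀ {F} → ThickStripesPreserved F → ∀ n₁ n₂ a b r →
  InG1 F (iso (lin true n₁ n₂) a b , r) → Even a × Even b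
swapping-evenTranslation (_ , _ , quarterTurns , _) true false a b r g =
  halves-even⁺ a b (quarterTurns _ r g (inj₁ refl) _ (anticlockwiseQuarterTurn-centre a b))
swapping-evenTranslation (_ , _ , quarterTurns , _) false true a b r g =
  halves-even⁻ a b (quarterTurns _ r g (inj₂ refl) _ (clockwiseQuarterTurn-centre a b))
swapping-evenTranslation stripes false false a b r g =
  halves-even⁻ a b (axisCondition-blockPoint (diagonalGlide a b)
    (diagonalAxisCondition stripes (diagonalGlide a b) g (inj₁ refl))
    (diagonal-throughBlockCentres a b) (diagonal-throughCellCentres a b))
swapping-evenTranslation stripes true true a b r g =
  halves-even⁺ a b (axisCondition-blockPoint (antidiagonalGlide a b)
    (diagonalAxisCondition stripes (antidiagonalGlide a b) g (inj₂ refl))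
    (antidiagonal-throughBlockCentres a b) (antidiagonal-throughCellCentres a b))

swapping-symmetry : ∀ {F} → Isonemal F →
  ∃ λ n₁ → ∃ λ n₂ → ∃ λ a → ∃ λ b → ∃ λ r → InG1 F (iso (lin true n₁ n₂) a b , r)
swapping-symmetry (_ , transitive) with transitive (warp (+ 0)) (weft (+ 0))
... | (iso (lin true n₁ n₂) a b , r) , g , _ = n₁ , n₂ , a , b , r , g
... | (iso (lin false _ _) _ _ , _) , _ , ()

even-cancel : ∀ m {a c} → Even a → Even (negateIf m a + c) → Even c
even-cancel false {c = c} (k , refl) (l , e) = l - k , (begin
  c                      ≡⟨ cancel k c ⟩
  + 2 * k + c - + 2 * k  ≡⟨ cong (_- + 2 * k) e ⟩
  + 2 * l - + 2 * k      ≡⟨ solve (l ∷ k ∷ []) ⟩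
  + 2 * (l - k)          ∎)
  where
  cancel : ∀ k c → c ≡ + 2 * k + c - + 2 * k
  cancel = solve-∀
even-cancel true {c = c} (k , refl) (l , e) = l + k , (begin
  c                         ≡⟨ cancel k c ⟩
  - (+ 2 * k) + c + + 2 * k ≡⟨ cong (_+ + 2 * k) e ⟩
  + 2 * l + + 2 * k         ≡⟨ *-distribˡ-+ (+ 2) l k ⟨
  + 2 * (l + k)             ∎)
  where
  cancel : ∀ k c → c ≡ - (+ 2 * k) + c + + 2 * k
  cancel = solve-∀

symmetry-evenTranslation : ∀ {F L a b r} → ThickStripesPreserved F → Isonemal F →
  InG1 F (iso L a b , r) → Even a × Even b
symmetry-evenTranslation {L = lin true n₁ n₂} stripes _ g =
  swapping-evenTranslation stripes n₁ n₂ _ _ _ g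
symmetry-evenTranslation {L = lin false m₁ m₂} {r = r} stripes isonemal g
  with swapping-symmetry isonemal
... | n₁ , n₂ , a , b , r' , h
  with swapping-evenTranslation stripes n₁ n₂ a b r' h
     | swapping-evenTranslation stripes _ _ _ _ _ (InG1-∘ r r' g h)
... | even-a , even-b | even-gh₁ , even-gh₂ =
  even-cancel m₁ even-a even-gh₁ , even-cancel m₂ even-b even-gh₂

colourImage : Lin → ℤ → ℤ → Colour → Colour
colourImage (lin false n₁ n₂) x y (warpPair p) = warpPair (mirrorCell n₁ p + x)
colourImage (lin false n₁ n₂) x y (weftPair p) = weftPair (mirrorCell n₂ p + y)
colourImage (lin true  n₁ n₂) x y (warpPair p) = weftPair (mirrorCell n₂ p + y)
colourImage (lin true  n₁ n₂) x y (weftPair p) = warpPair (mirrorCell n₁ p + x)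

colour-strandImage : ∀ L x y s →
  colour (strandImage (iso L (+ 2 * x) (+ 2 * y)) s) ≡ colourImage L x y (colour s)
colour-strandImage (lin false n₁ n₂) x y (warp i) = cong warpPair (/2-mirrorCell n₁ x i)
colour-strandImage (lin false n₁ n₂) x y (weft j) = cong weftPair (/2-mirrorCell n₂ y j)
colour-strandImage (lin true  n₁ n₂) x y (warp i) = cong weftPair (/2-mirrorCell n₂ y i)
colour-strandImage (lin true  n₁ n₂) x y (weft j) = cong warpPair (/2-mirrorCell n₁ x j)

colour-actStrand : ∀ L x y s →
  colour (actStrand (iso L (+ 2 * x) (+ 2 * y)) s) ≡ colourImage L x y (colour s)
colour-actStrand L x y s =
  trans (cong colour (actStrand≡strandImage (iso L (+ 2 * x) (+ 2 * y)) s)) (colour-strandImage L x y s)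

evenTranslation-colourSymmetry : ∀ L x y r → ColourSymmetry (iso L (+ 2 * x) (+ 2 * y) , r)
evenTranslation-colourSymmetry L x y r s s' same = begin
  colour (actStrand (iso L (+ 2 * x) (+ 2 * y)) s)   ≡⟨ colour-actStrand L x y s ⟩
  colourImage L x y (colour s)                      ≡⟨ cong (colourImage L x y) same ⟩
  colourImage L x y (colour s')                     ≡⟨ colour-actStrand L x y s' ⟨
  colour (actStrand (iso L (+ 2 * x) (+ 2 * y)) s') ∎

lemma1 : (F : Prefabric) → IsFabric F → Isonemal F → NonExceptional F →
    ThickStripesPreserved F → PerfectColouring F
lemma1 F _ isonemal _ stripes (iso L a b , r) g with symmetry-evenTranslation stripes isonemal g
... | (x , refl) , (y , refl) = evenTranslation-colourSymmetry L x y r
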